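{- Let $G=(V,E)$ be a graph with node weights $w:V\to\mathbb{N}$ and let $T\ge1$. Consider independent sets $I_1,\dots,I_T$ and weight functions $w_1,\dots,w_{T+1}$, $w_1',\dots,w_T'$ constructed as follows: $w_1=w$; $I_1$ is an arbitrary independent set of $G$; for each $i\in\{1,\dots,T\}$, $w_{i+1}(u)=\max\{0,\,w_i(u)-\sum_{v\in N^+(u)\cap I_i}w_i(v)\}$ and $w_i'(u)=w_i(u)-w_{i+1}(u)$ for all $u\in V$; for $i>1$, $I_i$ is an arbitrary independent set of the subgraph of $G$ induced by the nodes $v$ with $w_i(v)>0$. Then for all $i\in\{1,\dots,T\}$, $w_i(I_i)=w_i'(I_i)\ge S^*(w_i')$.
   Context: $N^+(v)=\{v\}\cup N(v)$; $f(S)=\sum_{v\in S}f(v)$. For a non-negative weight function $f$ on $V$, $S^*(f)$ is the optimal value of the linear program $\max\sum_{v\in V}f(v)x_v$ subject to $\sum_{u\in N^+(v)}x_u\le1$ for all $v\in V$ and $x_v\ge0$.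
   Formalization: The variables $x_v$ of the linear program defining $S^*(w_i')$ range only over the rationals. -}

module Defs where

open import Data.Nat as ℕ using (ℕ; zero; suc; _∸_)
open import Data.Bool using (Bool; true; false; if_then_else_; _∨_)
open import Data.Fin using (Fin; zero; suc; _≟_)
open import Data.Fin.Subset using (Subset)
open import Data.Vec using (lookup)
open import Data.Integer using (+_)
open import Data.Rational as ℚ using (ℚ; 0ℚ; 1ℚ; _/_)
open import Relation.Nullary.Decidable using (⌊_⌋)
open import Relation.Binary.PropositionalEquality using (_≡_)
open import Data.Empty using (⊥)

record Graph (n : ℕ) : Set where
  field
    adj   : Fin n → Fin n → Bool
    sym   : ∀ u v → adj u v ≡ adj v u
    irrefl : ∀ v → adj v v ≡ false
open Graph public

Σℕ : ∀ {n} → (Fin n → ℕ) → ℕ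
Σℕ {zero}  f = 0
Σℕ {suc n} f = f zero ℕ.+ Σℕ (λ i → f (suc i))

Σℚ : ∀ {n} → (Fin n → ℚ) → ℚ
Σℚ {zero}  f = 0ℚ
Σℚ {suc n} f = f zero ℚ.+ Σℚ (λ i → f (suc i))

inN⁺ : ∀ {n} → Graph n → Fin n → Fin n → Bool
inN⁺ G u v = ⌊ u ≟ v ⌋ ∨ adj G u v

weightOf : ∀ {n} → (Fin n → ℕ) → Subset n → ℕ
weightOf f S = Σℕ (λ v → if lookup S v then f v else 0)

Independent : ∀ {n} → Graph n → Subset n → Set
Independent G S = ∀ u v → lookup S u ≡ true → lookup S v ≡ true → adj G u v ≡ true → ⊥

nextWeight : ∀ {n} → Graph n → (Fin n → ℕ) → Subset n → (Fin n → ℕ)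
nextWeight G w I u =
  w u ∸ Σℕ (λ v → if inN⁺ G u v then (if lookup I v then w v else 0) else 0)

-- The weight sequence, 1-indexed as in the paper: wSeq G w I i = w_i for i ≥ 1.
-- (wSeq … 0 is an unused dummy value.)
wSeq : ∀ {n} → Graph n → (Fin n → ℕ) → (ℕ → Subset n) → ℕ → (Fin n → ℕ)
wSeq G w I zero = w
wSeq G w I (suc zero) = w
wSeq G w I (suc (suc k)) = nextWeight G (wSeq G w I (suc k)) (I (suc k))

-- w_i'(u) = w_i(u) - w_{i+1}(u)  (always ≥ 0, since w_{i+1} ≤ w_i)
wPrime : ∀ {n} → Graph n → (Fin n → ℕ) → (ℕ → Subset n) → ℕ → (Fin n → ℕ)
wPrime G w I i u = wSeq G w I i u ∸ wSeq G w I (suc i) u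

toℚ : ℕ → ℚ
toℚ k = + k / 1

LPFeasible : ∀ {n} → Graph n → (Fin n → ℚ) → Set
LPFeasible G x =
  (∀ v → 0ℚ ℚ.≤ x v) ×' (∀ v → Σℚ (λ u → if inN⁺ G v u then x u else 0ℚ) ℚ.≤ 1ℚ)
  where open import Data.Product renaming (_×_ to _×'_)

-- S*(f) ≤ c  :⇔  every feasible x has objective Σ f(v) x_v ≤ c
S*≤ : ∀ {n} → Graph n → (Fin n → ℕ) → ℚ → Set
S*≤ G f c = ∀ x → LPFeasible G x → Σℚ (λ v → toℚ (f v) ℚ.* x v) ℚ.≤ c

-- For v ∈ I the closed neighbourhood N⁺(v) contains v itself, so w(v) is entirely
-- absorbed and w'(v) = w(v); this gives w(I) = w'(I).  In general
-- w'(u) ≤ Σ_{v ∈ N⁺(u) ∩ I} w(v), so for every feasible x, exchanging the order of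
-- summation and using the symmetry of N⁺,
--   Σ_u w'(u) x_u ≤ Σ_{v ∈ I} w(v) Σ_{u ∈ N⁺(v)} x_u ≤ Σ_{v ∈ I} w(v) = w'(I).
module Submission where

open import Defs hiding (sym)
open import Algebra.Bundles using (CommutativeRing)
open import Data.Bool using (Bool; true; false; if_then_else_)
open import Data.Fin using (Fin; zero; suc; _≟_)
open import Data.Fin.Subset using (Subset)
open import Data.Integer as ℤ using (+_)
import Data.Integer.Properties as ℤP
open import Data.Nat as ℕ using (ℕ; suc; _∸_; _≤_; _<_)
import Data.Nat.Properties as ℕP
open import Data.Nat.Coprimality as Coprime using (1-coprimeTo)
open import Data.Product using (_×_; _,_)
open import Data.Rational as ℚ using (ℚ; mkℚ; 0ℚ; 1ℚ)
import Data.Rational.Properties as ℚP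
open import Data.Vec using (lookup)
open import Relation.Nullary using (yes; no; contradiction)
open import Relation.Binary.PropositionalEquality
  using (_≡_; refl; sym; trans; cong; cong₂; subst; subst₂; module ≡-Reasoning)

open import Algebra.Properties.Semiring.Sum (CommutativeRing.semiring ℚP.+-*-commutativeRing)
  using (sum; sum-cong-≗; ∑-comm; *-distribˡ-sum; *-distribʳ-sum)

toℚ≡mkℚ : ∀ a → toℚ a ≡ mkℚ (+ a) 0 (Coprime.sym (1-coprimeTo a))
toℚ≡mkℚ a = ℚP.normalize-coprime (Coprime.sym (1-coprimeTo a))

toℚ-+ : ∀ a b → toℚ (a ℕ.+ b) ≡ toℚ a ℚ.+ toℚ b
toℚ-+ a b rewrite toℚ≡mkℚ a | toℚ≡mkℚ b =
  cong (ℚ._/ 1) (sym (cong₂ ℤ._+_ (ℤP.*-identityʳ (+ a)) (ℤP.*-identityʳ (+ b))))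

toℚ-mono-≤ : ∀ {a b} → a ≤ b → toℚ a ℚ.≤ toℚ b
toℚ-mono-≤ {a} {b} a≤b rewrite toℚ≡mkℚ a | toℚ≡mkℚ b =
  ℚ.*≤* (subst₂ ℤ._≤_ (sym (ℤP.*-identityʳ (+ a))) (sym (ℤP.*-identityʳ (+ b))) (ℤ.+≤+ a≤b))

toℚ-nonNeg : ∀ a → ℚ.NonNegative (toℚ a)
toℚ-nonNeg a = ℚP.normalize-nonNeg a 1

toℚ-Σℕ : ∀ {n} (f : Fin n → ℕ) → toℚ (Σℕ f) ≡ Σℚ (λ i → toℚ (f i))
toℚ-Σℕ {ℕ.zero} f = refl
toℚ-Σℕ {suc n}  f = trans (toℚ-+ (f zero) _) (cong (toℚ (f zero) ℚ.+_) (toℚ-Σℕ (λ i → f (suc i))))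

Σℚ≡sum : ∀ {n} (f : Fin n → ℚ) → Σℚ f ≡ sum f
Σℚ≡sum {ℕ.zero} f = refl
Σℚ≡sum {suc n}  f = cong (f zero ℚ.+_) (Σℚ≡sum (λ i → f (suc i)))

Σℚ-cong : ∀ {n} {f g : Fin n → ℚ} → (∀ i → f i ≡ g i) → Σℚ f ≡ Σℚ g
Σℚ-cong {f = f} {g} f≗g = trans (Σℚ≡sum f) (trans (sum-cong-≗ f≗g) (sym (Σℚ≡sum g)))

Σℚ-mono-≤ : ∀ {n} {f g : Fin n → ℚ} → (∀ i → f i ℚ.≤ g i) → Σℚ f ℚ.≤ Σℚ g
Σℚ-mono-≤ {ℕ.zero} f≤g = ℚP.≤-refl
Σℚ-mono-≤ {suc n}  f≤g = ℚP.+-mono-≤ (f≤g zero) (Σℚ-mono-≤ (λ i → f≤g (suc i)))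

Σℚ-comm : ∀ {m n} (f : Fin m → Fin n → ℚ) →
          Σℚ (λ i → Σℚ (f i)) ≡ Σℚ (λ j → Σℚ (λ i → f i j))
Σℚ-comm f = begin
  Σℚ (λ i → Σℚ (f i))              ≡⟨ trans (Σℚ≡sum (λ i → Σℚ (f i))) (sum-cong-≗ (λ i → Σℚ≡sum (f i))) ⟩
  sum (λ i → sum (f i))            ≡⟨ ∑-comm f ⟩
  sum (λ j → sum (λ i → f i j))    ≡⟨ sym (trans (Σℚ≡sum (λ j → Σℚ (λ i → f i j))) (sum-cong-≗ (λ j → Σℚ≡sum (λ i → f i j)))) ⟩
  Σℚ (λ j → Σℚ (λ i → f i j))      ∎
  where open ≡-Reasoning

*-distribˡ-Σℚ : ∀ {n} c (f : Fin n → ℚ) → c ℚ.* Σℚ f ≡ Σℚ (λ i → c ℚ.* f i)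
*-distribˡ-Σℚ c f = begin
  c ℚ.* Σℚ f                ≡⟨ cong (c ℚ.*_) (Σℚ≡sum f) ⟩
  c ℚ.* sum f               ≡⟨ *-distribˡ-sum c f ⟩
  sum (λ i → c ℚ.* f i)     ≡⟨ sym (Σℚ≡sum (λ i → c ℚ.* f i)) ⟩
  Σℚ (λ i → c ℚ.* f i)      ∎
  where open ≡-Reasoning

*-distribʳ-Σℚ : ∀ {n} c (f : Fin n → ℚ) → Σℚ f ℚ.* c ≡ Σℚ (λ i → f i ℚ.* c)
*-distribʳ-Σℚ c f = begin
  Σℚ f ℚ.* c                ≡⟨ cong (ℚ._* c) (Σℚ≡sum f) ⟩
  sum f ℚ.* c               ≡⟨ *-distribʳ-sum c f ⟩
  sum (λ i → f i ℚ.* c)     ≡⟨ sym (Σℚ≡sum (λ i → f i ℚ.* c)) ⟩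
  Σℚ (λ i → f i ℚ.* c)      ∎
  where open ≡-Reasoning

Σℕ-≥-term : ∀ {n} (f : Fin n → ℕ) i → f i ≤ Σℕ f
Σℕ-≥-term f zero    = ℕP.m≤m+n (f zero) _
Σℕ-≥-term f (suc i) = ℕP.≤-trans (Σℕ-≥-term (λ j → f (suc j)) i) (ℕP.m≤n+m _ (f zero))

toℚ-if-* : ∀ (b : Bool) c y → toℚ (if b then c else 0) ℚ.* y ≡ toℚ c ℚ.* (if b then y else 0ℚ)
toℚ-if-* true  c y = refl
toℚ-if-* false c y = trans (ℚP.*-zeroˡ y) (sym (ℚP.*-zeroʳ (toℚ c)))

m∸[m∸n]≤n : ∀ m n → m ∸ (m ∸ n) ≤ n
m∸[m∸n]≤n m n = ℕP.m≤n+o⇒m∸n≤o m (m ∸ n) (subst (m ≤_) (ℕP.+-comm n (m ∸ n)) (ℕP.m≤n+m∸n m n))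

restrictTo : ∀ {n} → Subset n → (Fin n → ℕ) → Fin n → ℕ
restrictTo S f v = if lookup S v then f v else 0

weightOf-cong : ∀ {n} (S : Subset n) {f g : Fin n → ℕ} →
                (∀ v → lookup S v ≡ true → f v ≡ g v) → weightOf f S ≡ weightOf g S
weightOf-cong S {f} {g} f≡g = Σℕ-cong restrict-cong
  where
  Σℕ-cong : ∀ {m} {h k : Fin m → ℕ} → (∀ i → h i ≡ k i) → Σℕ h ≡ Σℕ k
  Σℕ-cong {ℕ.zero} h≗k = refl
  Σℕ-cong {suc m}  h≗k = cong₂ ℕ._+_ (h≗k zero) (Σℕ-cong (λ i → h≗k (suc i)))

  restrict-cong : ∀ v → restrictTo S f v ≡ restrictTo S g v
  restrict-cong v with lookup S v in v∈S
  ... | true  = f≡g v v∈S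
  ... | false = refl

module _ {n} (G : Graph n) where

  N⁺-sum : (Fin n → ℕ) → Fin n → ℕ
  N⁺-sum f u = Σℕ (λ v → if inN⁺ G u v then f v else 0)

  inN⁺-refl : ∀ v → inN⁺ G v v ≡ true
  inN⁺-refl v with v ≟ v
  ... | yes _  = refl
  ... | no v≢v = contradiction refl v≢v

  inN⁺-sym : ∀ u v → inN⁺ G u v ≡ inN⁺ G v u
  inN⁺-sym u v with u ≟ v | v ≟ u
  ... | yes _    | yes _    = refl
  ... | no _     | no _     = Graph.sym G u v
  ... | yes refl | no v≢u   = contradiction refl v≢u
  ... | no u≢v   | yes refl = contradiction refl u≢v

  ≤-N⁺-sum : ∀ f v → f v ≤ N⁺-sum f v
  ≤-N⁺-sum f v = subst (λ b → (if b then f v else 0) ≤ N⁺-sum f v) (inN⁺-refl v)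
                       (Σℕ-≥-term (λ u → if inN⁺ G v u then f u else 0) v)

  -- Weak LP duality: each a(u) is charged once for every v ∈ N⁺(u), and feasibility
  -- bounds Σ_{v ∈ N⁺(u)} x_v by 1.
  N⁺-sum-packing : ∀ a x → LPFeasible G x →
                   Σℚ (λ v → toℚ (N⁺-sum a v) ℚ.* x v) ℚ.≤ toℚ (Σℕ a)
  N⁺-sum-packing a x (_ , covered) = begin
    Σℚ (λ v → toℚ (N⁺-sum a v) ℚ.* x v)
      ≡⟨ Σℚ-cong (λ v → trans (cong (ℚ._* x v) (toℚ-Σℕ (λ u → charge v u)))
                               (*-distribʳ-Σℚ (x v) (λ u → toℚ (charge v u)))) ⟩
    Σℚ (λ v → Σℚ (λ u → toℚ (charge v u) ℚ.* x v))
      ≡⟨ Σℚ-comm (λ v u → toℚ (charge v u) ℚ.* x v) ⟩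
    Σℚ (λ u → Σℚ (λ v → toℚ (charge v u) ℚ.* x v))
      ≡⟨ Σℚ-cong column ⟩
    Σℚ (λ u → toℚ (a u) ℚ.* Σℚ (λ v → if inN⁺ G u v then x v else 0ℚ))
      ≤⟨ Σℚ-mono-≤ (λ u → ℚP.*-monoˡ-≤-nonNeg (toℚ (a u)) {{toℚ-nonNeg (a u)}} (covered u)) ⟩
    Σℚ (λ u → toℚ (a u) ℚ.* 1ℚ)
      ≡⟨ Σℚ-cong (λ u → ℚP.*-identityʳ (toℚ (a u))) ⟩
    Σℚ (λ u → toℚ (a u))
      ≡⟨ sym (toℚ-Σℕ a) ⟩
    toℚ (Σℕ a) ∎
    where
    open ℚP.≤-Reasoning

    charge : Fin n → Fin n → ℕ
    charge v u = if inN⁺ G v u then a u else 0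

    column : ∀ u → Σℚ (λ v → toℚ (charge v u) ℚ.* x v)
                   ≡ toℚ (a u) ℚ.* Σℚ (λ v → if inN⁺ G u v then x v else 0ℚ)
    column u = trans
      (Σℚ-cong (λ v → trans (toℚ-if-* (inN⁺ G v u) (a u) (x v))
                            (cong (λ b → toℚ (a u) ℚ.* (if b then x v else 0ℚ)) (inN⁺-sym v u))))
      (sym (*-distribˡ-Σℚ (toℚ (a u)) (λ v → if inN⁺ G u v then x v else 0ℚ)))

module _ {n} (G : Graph n) (w : Fin n → ℕ) (I : Subset n) where

  weightDrop : Fin n → ℕ
  weightDrop u = w u ∸ nextWeight G w I u

  weightDrop-≤ : ∀ u → weightDrop u ≤ N⁺-sum G (restrictTo I w) u
  weightDrop-≤ u = m∸[m∸n]≤n (w u) (N⁺-sum G (restrictTo I w) u)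

  nextWeight-∈ : ∀ v → lookup I v ≡ true → nextWeight G w I v ≡ 0
  nextWeight-∈ v v∈I = ℕP.m≤n⇒m∸n≡0
    (subst (λ b → (if b then w v else 0) ≤ N⁺-sum G (restrictTo I w) v) v∈I
           (≤-N⁺-sum G (restrictTo I w) v))

  weightOf-weightDrop : weightOf w I ≡ weightOf weightDrop I
  weightOf-weightDrop = weightOf-cong I (λ v v∈I → sym (cong (w v ∸_) (nextWeight-∈ v v∈I)))

  weightDrop-S*≤ : S*≤ G weightDrop (toℚ (weightOf weightDrop I))
  weightDrop-S*≤ x feasible@(nonneg , _) = begin
    Σℚ (λ v → toℚ (weightDrop v) ℚ.* x v)
      ≤⟨ Σℚ-mono-≤ (λ v → ℚP.*-monoʳ-≤-nonNeg (x v) {{ℚ.nonNegative (nonneg v)}}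
                                               (toℚ-mono-≤ (weightDrop-≤ v))) ⟩
    Σℚ (λ v → toℚ (N⁺-sum G (restrictTo I w) v) ℚ.* x v)
      ≤⟨ N⁺-sum-packing G (restrictTo I w) x feasible ⟩
    toℚ (weightOf w I)
      ≡⟨ cong toℚ weightOf-weightDrop ⟩
    toℚ (weightOf weightDrop I) ∎
    where open ℚP.≤-Reasoning

lemma4p5 : ∀ {n} (G : Graph n) (w : Fin n → ℕ) (T : ℕ) → 1 ≤ T
    → (I : ℕ → Subset n)
    → Independent G (I 1)
    → (∀ i → 1 < i → i ≤ T →
    Independent G (I i) × (∀ v → lookup (I i) v ≡ true → 0 < wSeq G w I i v))
    → ∀ i → 1 ≤ i → i ≤ T →
    (weightOf (wSeq G w I i) (I i) ≡ weightOf (wPrime G w I i) (I i))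
    × S*≤ G (wPrime G w I i) (toℚ (weightOf (wPrime G w I i) (I i)))
lemma4p5 G w T _ I _ _ (suc k) _ _ =
  weightOf-weightDrop G (wSeq G w I (suc k)) (I (suc k)) ,
  weightDrop-S*≤ G (wSeq G w I (suc k)) (I (suc k))
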